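{- Let $D$ be a digraph. Then $\langle D\rangle$ is $0$-simple if and only if $D$ has exactly one non-trivial connected component, and this component is isomorphic to one of the following two digraphs on vertices $\{a,b,c\}$: the digraph with arcs $(b,c),(c,b),(c,a)$; or the digraph with arcs $(b,a),(b,c),(c,b),(c,a)$.
   Context: For $x\neq y$ in $\{1,\ldots,n\}$, $(x\to y)$ denotes the transformation mapping $x$ to $y$ and fixing every other point; transformations are composed left to right. For a digraph $D$ on $\{1,\ldots,n\}$ (no loops, no multiple arcs), $\langle D\rangle$ is the semigroup generated by all $(x\to y)$ with $(x,y)$ an arc. Connected components are those of the underlying undirected graph; non-trivial means having more than one vertex. A semigroup $S$ with zero $0$ is $0$-simple if $S^2\neq\{0\}$ and its $\mathscr{J}$-classes are exactly $\{0\}$ and $S\setminus\{0\}$. -}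

module Defs where

open import Data.Nat using (ℕ)
open import Data.Fin using (Fin; zero; suc; _≟_)
open import Data.Vec using (Vec; tabulate; lookup)
open import Data.Bool using (Bool; true; false)
open import Data.Sum using (_⊎_)
open import Data.Product using (Σ; ∃; _×_)
open import Relation.Nullary using (¬_; yes; no)
open import Relation.Binary.PropositionalEquality using (_≡_; _≢_)
open import Relation.Binary.Construct.Closure.ReflexiveTransitive using (Star)
open import Function.Bundles using (_⇔_)

-- A digraph on {1,…,n} (here Fin n): a Boolean adjacency relation with no loops.
-- (No multiple arcs is automatic for a relation.)
Digraph : ℕ → Set
Digraph n = Fin n → Fin n → Bool

Loopless : ∀ {n} → Digraph n → Set
Loopless {n} D = ∀ (x : Fin n) → D x x ≡ false

Arc : ∀ {n} → Digraph n → Fin n → Fin n → Set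
Arc D x y = D x y ≡ true

-- Transformations of Fin n, represented by their table of values
-- (so that propositional equality is equality of maps).
Transformation : ℕ → Set
Transformation n = Vec (Fin n) n

arrow : ∀ {n} → Fin n → Fin n → Transformation n
arrow x y = tabulate (λ z → f z)
  where
  f : _ → _
  f z with z ≟ x
  ... | yes _ = y
  ... | no _ = z

-- Composition from left to right: (s ∙ t)(z) = t (s z).
infixl 7 _∙_
_∙_ : ∀ {n} → Transformation n → Transformation n → Transformation n
s ∙ t = tabulate (λ z → lookup t (lookup s z))

idT : ∀ {n} → Transformation n
idT = tabulate (λ z → z)

data ⟨_⟩∋_ {n : ℕ} (D : Digraph n) : Transformation n → Set where
  gen : ∀ {x y} → Arc D x y → ⟨ D ⟩∋ arrow x y
  mul : ∀ {s t} → ⟨ D ⟩∋ s → ⟨ D ⟩∋ t → ⟨ D ⟩∋ (s ∙ t)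

⟨_⟩¹∋_ : ∀ {n} → Digraph n → Transformation n → Set
⟨ D ⟩¹∋ u = u ≡ idT ⊎ ⟨ D ⟩∋ u

_≤J[_]_ : ∀ {n} → Transformation n → Digraph n → Transformation n → Set
a ≤J[ D ] b = Σ _ λ u → Σ _ λ v → ⟨ D ⟩¹∋ u × ⟨ D ⟩¹∋ v × a ≡ u ∙ b ∙ v

_J[_]_ : ∀ {n} → Transformation n → Digraph n → Transformation n → Set
a J[ D ] b = (a ≤J[ D ] b) × (b ≤J[ D ] a)

IsZero : ∀ {n} → Digraph n → Transformation n → Set
IsZero D z = ⟨ D ⟩∋ z × (∀ s → ⟨ D ⟩∋ s → (s ∙ z ≡ z) × (z ∙ s ≡ z))

-- ⟨D⟩ is 0-simple: it has a zero 0, S² ≠ {0}, and its J-classes are exactly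
-- {0} and S ∖ {0} (i.e. for a, b ∈ S:  a J b  iff  (a = 0 iff b = 0)).
ZeroSimple : ∀ {n} → Digraph n → Set
ZeroSimple D =
  Σ _ λ z → IsZero D z
    × (Σ _ λ a → Σ _ λ b → ⟨ D ⟩∋ a × ⟨ D ⟩∋ b × a ∙ b ≢ z)
    × (∀ a b → ⟨ D ⟩∋ a → ⟨ D ⟩∋ b → (a J[ D ] b) ⇔ ((a ≡ z) ⇔ (b ≡ z)))

Adj : ∀ {n} → Digraph n → Fin n → Fin n → Set
Adj D x y = Arc D x y ⊎ Arc D y x

Connected : ∀ {n} → Digraph n → Fin n → Fin n → Set
Connected D = Star (Adj D)

NonTrivial : ∀ {n} → Digraph n → Fin n → Set
NonTrivial D x = Σ _ λ y → y ≢ x × Connected D x y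

-- The two target digraphs on {a,b,c} = {zero, 1, 2} (a = 0, b = 1, c = 2).
-- H₁ : arcs (b,c), (c,b), (c,a).
H₁ : Digraph 3
H₁ (suc zero) (suc (suc zero)) = true
H₁ (suc (suc zero)) (suc zero) = true
H₁ (suc (suc zero)) zero = true
H₁ _ _ = false

H₂ : Digraph 3
H₂ (suc zero) zero = true
H₂ (suc zero) (suc (suc zero)) = true
H₂ (suc (suc zero)) (suc zero) = true
H₂ (suc (suc zero)) zero = true
H₂ _ _ = false

ComponentIso : ∀ {n} → Digraph n → Fin n → Digraph 3 → Set
ComponentIso {n} D v H =
  Σ (Fin 3 → Fin n) λ φ →
      (∀ i j → φ i ≡ φ j → i ≡ j)
    × (∀ i → Connected D v (φ i))
    × (∀ x → Connected D v x → ∃ λ i → φ i ≡ x)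
    × (∀ i j → D (φ i) (φ j) ≡ H i j)

UniqueComponentIso : ∀ {n} → Digraph n → Set
UniqueComponentIso D =
  Σ _ λ v → NonTrivial D v
    × (∀ x → NonTrivial D x → Connected D v x)
    × (ComponentIso D v H₁ ⊎ ComponentIso D v H₂)

module Submission where

-- (⇒) Let z be the zero.  Absorption alone shows that z identifies the ends of
-- every arc and that no value of z is a tail; hence no generator is zero.  As
-- all non-zero elements are J-related we get two key facts: a rank
-- (pigeonhole) argument gives (x → y)(u → v) = z whenever u, v ≠ x, and a
-- vertex without in-arcs is the tail of every arc.  With them D contains two
-- such independent arcs, and evaluating z = (x → y)(u → v) pins D down to the
-- common shape of H₁ and H₂ (record Shape), which is the claimed component.
--
-- (⇐) Elements of ⟨H₁⟩ and ⟨H₂⟩ fix the sink a, so they are determined by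
-- their "profile" (images of b and c).  Finite tables of profiles, certified by
-- decision procedures, are exactly ⟨H₁⟩ and ⟨H₂⟩ and are 0-simple; embedding
-- them along the isomorphism, fixing all other vertices, identifies ⟨D⟩ with
-- the table.

open import Defs
open import Data.Nat using (ℕ; suc)
open import Data.Nat.Properties using (<-irrefl)
open import Data.Fin using (Fin; zero; suc; _≟_; punchOut)
open import Data.Fin.Properties using (punchOut-injective; injective⇒≤; any?; all?)
open import Data.Vec using (lookup; tabulate)
open import Data.Vec.Properties using (lookup∘tabulate; tabulate∘lookup; tabulate-cong)
import Data.Vec.Properties as Vec
open import Data.Bool using (Bool; true; false)
import Data.Bool as Bool
open import Data.Sum using (_⊎_; inj₁; inj₂)
import Data.Product.Properties as ×
open import Data.Product using (Σ; ∃; ∃₂; _×_; _,_; proj₁; proj₂)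
open import Data.Empty using (⊥; ⊥-elim)
open import Function using (_∋_)
open import Function.Bundles using (_⇔_; mk⇔; Equivalence)
open import Relation.Nullary using (¬_; Dec; yes; no; contradiction)
open import Relation.Nullary.Decidable using (_×-dec_; _⊎-dec_; _→-dec_; ¬?; map′; from-yes)
open import Relation.Binary.PropositionalEquality
open import Relation.Binary.Definitions using (DecidableEquality)
open import Relation.Binary.Construct.Closure.ReflexiveTransitive using (ε; _◅_)

lookup-∙ : ∀ {n} (s t : Transformation n) (w : Fin n) → lookup (s ∙ t) w ≡ lookup t (lookup s w)
lookup-∙ s t w = lookup∘tabulate _ w

lookup-idT : ∀ {n} (w : Fin n) → lookup idT w ≡ w
lookup-idT w = lookup∘tabulate _ w

transformation-ext : ∀ {n} {s t : Transformation n} → (∀ w → lookup s w ≡ lookup t w) → s ≡ t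
transformation-ext {s = s} {t} s≗t = begin
  s                      ≡⟨ tabulate∘lookup s ⟨
  tabulate (lookup s)    ≡⟨ tabulate-cong s≗t ⟩
  tabulate (lookup t)    ≡⟨ tabulate∘lookup t ⟩
  t                      ∎
  where open ≡-Reasoning

lookup-∙₃ : ∀ {n} (s g t : Transformation n) (w : Fin n) →
            lookup (s ∙ g ∙ t) w ≡ lookup t (lookup g (lookup s w))
lookup-∙₃ s g t w = trans (lookup-∙ (s ∙ g) t w) (cong (lookup t) (lookup-∙ s g w))

∙-identityˡ : ∀ {n} (s : Transformation n) → idT ∙ s ≡ s
∙-identityˡ s = transformation-ext λ w → trans (lookup-∙ idT s w) (cong (lookup s) (lookup-idT w))

∙-identityʳ : ∀ {n} (s : Transformation n) → s ∙ idT ≡ s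
∙-identityʳ s = transformation-ext λ w → trans (lookup-∙ s idT w) (lookup-idT (lookup s w))

≤J-refl : ∀ {n} {D : Digraph n} (s : Transformation n) → s ≤J[ D ] s
≤J-refl s = idT , idT , inj₁ refl , inj₁ refl , sym (trans (∙-identityʳ (idT ∙ s)) (∙-identityˡ s))

-- The two defining values of (x → y).  Abstracting the test w ≟ x together
-- with the equation lookup∘tabulate exposes the case split inside arrow.
arrow-source : ∀ {n} (x y : Fin n) → lookup (arrow x y) x ≡ y
arrow-source x y with x ≟ x | (lookup (arrow x y) x ≡ _ ∋ lookup∘tabulate _ x)
... | yes _   | eq = eq
... | no x≢x | _  = contradiction refl x≢x

arrow-elsewhere : ∀ {n} {x w : Fin n} (y : Fin n) → w ≢ x → lookup (arrow x y) w ≡ w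
arrow-elsewhere {x = x} {w} y w≢x with w ≟ x | (lookup (arrow x y) w ≡ _ ∋ lookup∘tabulate _ w)
... | yes w≡x | _  = contradiction w≡x w≢x
... | no _    | eq = eq

arrow-value : ∀ {n} (x y w : Fin n) → lookup (arrow x y) w ≡ y ⊎ lookup (arrow x y) w ≡ w
arrow-value x y w with w ≟ x
... | yes refl = inj₁ (arrow-source w y)
... | no w≢x   = inj₂ (arrow-elsewhere y w≢x)

arrow-avoids : ∀ {n} {x y w c : Fin n} → w ≢ c → y ≢ c → lookup (arrow x y) w ≢ c
arrow-avoids {x = x} {y} {w} w≢c y≢c with arrow-value x y w
... | inj₁ eq = λ e → y≢c (trans (sym eq) e)
... | inj₂ eq = λ e → w≢c (trans (sym eq) e)

arrow-avoids-source : ∀ {n} {x y : Fin n} → y ≢ x → ∀ w → lookup (arrow x y) w ≢ x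
arrow-avoids-source {x = x} y≢x w with w ≟ x
... | yes refl = λ e → y≢x (trans (sym (arrow-source w _)) e)
... | no w≢x   = arrow-avoids w≢x y≢x

-- Pigeonhole: for u ≠ x, there is no injection of Fin n ∖ {x} into Fin n ∖ {x, u}.
-- (This is the rank argument: a transformation of rank n - 1 is not a factor
-- of one of rank at most n - 2.)
no-injection-into-smaller : ∀ {n} {x u : Fin n} → u ≢ x → (r : Fin n → Fin n) →
  (∀ w → w ≢ x → r w ≢ x × r w ≢ u) →
  (∀ {w w'} → w ≢ x → w' ≢ x → r w ≡ r w' → w ≡ w') → ⊥
no-injection-into-smaller {suc m} {x} {u} u≢x r avoids injective =
  <-irrefl refl (injective⇒≤ punched-injective)
  where
  extended : Fin (suc m) → ∃ λ y → x ≢ y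
  extended w with w ≟ x
  ... | yes _  = u , ≢-sym u≢x
  ... | no w≢x = r w , ≢-sym (proj₁ (avoids w w≢x))

  extended-injective : ∀ w w' → proj₁ (extended w) ≡ proj₁ (extended w') → w ≡ w'
  extended-injective w w' eq with w ≟ x | w' ≟ x
  ... | yes w≡x | yes w'≡x = trans w≡x (sym w'≡x)
  ... | yes _   | no w'≢x  = contradiction (sym eq) (proj₂ (avoids w' w'≢x))
  ... | no w≢x  | yes _    = contradiction eq (proj₂ (avoids w w≢x))
  ... | no w≢x  | no w'≢x  = injective w≢x w'≢x eq

  punched : Fin (suc m) → Fin m
  punched w = punchOut (proj₂ (extended w))

  punched-injective : ∀ {w w'} → punched w ≡ punched w' → w ≡ w'
  punched-injective {w} {w'} eq =
    extended-injective w w' (punchOut-injective (proj₂ (extended w)) (proj₂ (extended w')) eq)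

arc-irreflexive : ∀ {n} (D : Digraph n) → Loopless D → ∀ {x y} → Arc D x y → x ≢ y
arc-irreflexive D loopless {x} arc refl with trans (sym arc) (loopless x)
... | ()

module Generated {n : ℕ} (D : Digraph n) where

  Tail : Fin n → Set
  Tail w = ∃ λ q → Arc D w q

  Head : Fin n → Set
  Head w = ∃ λ p → Arc D p w

  fixes-non-tails : ∀ {s} → ⟨ D ⟩∋ s → ∀ w → lookup s w ≡ w ⊎ Tail w
  fixes-non-tails (gen {x} {y} x→y) w with w ≟ x
  ... | yes refl = inj₂ (y , x→y)
  ... | no w≢x   = inj₁ (arrow-elsewhere y w≢x)
  fixes-non-tails (mul {s} {t} s∈ t∈) w with fixes-non-tails s∈ w | fixes-non-tails t∈ w
  ... | inj₂ tail | _         = inj₂ tail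
  ... | inj₁ _    | inj₂ tail = inj₂ tail
  ... | inj₁ sw≡w | inj₁ tw≡w = inj₁ (trans (lookup-∙ s t w) (trans (cong (lookup t) sw≡w) tw≡w))

  moves-onto-heads : ∀ {s} → ⟨ D ⟩∋ s → ∀ w → lookup s w ≡ w ⊎ Head (lookup s w)
  moves-onto-heads (gen {x} {y} x→y) w with w ≟ x
  ... | yes refl = inj₂ (w , subst (Arc D w) (sym (arrow-source w y)) x→y)
  ... | no w≢x   = inj₁ (arrow-elsewhere y w≢x)
  moves-onto-heads (mul {s} {t} s∈ t∈) w
    rewrite lookup-∙ s t w with moves-onto-heads t∈ (lookup s w)
  ... | inj₂ head = inj₂ head
  ... | inj₁ tsw≡sw with moves-onto-heads s∈ w
  ...   | inj₁ sw≡w = inj₁ (trans tsw≡sw sw≡w)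
  ...   | inj₂ head = inj₂ (subst Head (sym tsw≡sw) head)

  moves-onto-heads¹ : ∀ {s} → ⟨ D ⟩¹∋ s → ∀ w → lookup s w ≡ w ⊎ Head (lookup s w)
  moves-onto-heads¹ (inj₁ refl) w = inj₁ (lookup-idT w)
  moves-onto-heads¹ (inj₂ s∈)   w = moves-onto-heads s∈ w

  preserves-closed : (P : Fin n → Set) → (∀ {p q} → Arc D p q → P p → P q) →
                     ∀ {s} → ⟨ D ⟩∋ s → ∀ {w} → P w → P (lookup s w)
  preserves-closed P closed (gen {x} {y} x→y) {w} Pw with w ≟ x
  ... | yes refl = subst P (sym (arrow-source w y)) (closed x→y Pw)
  ... | no w≢x   = subst P (sym (arrow-elsewhere y w≢x)) Pw
  preserves-closed P closed (mul {s} {t} s∈ t∈) {w} Pw =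
    subst P (sym (lookup-∙ s t w)) (preserves-closed P closed t∈ (preserves-closed P closed s∈ Pw))

  has-arc : ∀ {s} → ⟨ D ⟩∋ s → ∃₂ λ x y → Arc D x y
  has-arc (gen {x} {y} x→y) = x , y , x→y
  has-arc (mul s∈ _)        = has-arc s∈

module Zero {n : ℕ} (D : Digraph n) (loopless : Loopless D)
            (z : Transformation n) (z-zero : IsZero D z) where

  absorbsˡ : ∀ {s} → ⟨ D ⟩∋ s → s ∙ z ≡ z
  absorbsˡ {s} s∈ = proj₁ (proj₂ z-zero s s∈)

  absorbsʳ : ∀ {s} → ⟨ D ⟩∋ s → z ∙ s ≡ z
  absorbsʳ {s} s∈ = proj₂ (proj₂ z-zero s s∈)

  -- From (p → q) z = z: the zero identifies both ends of an arc.
  zero-merges-arc : ∀ {p q} → Arc D p q → lookup z p ≡ lookup z q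
  zero-merges-arc {p} {q} p→q = begin
    lookup z p                       ≡⟨ cong (λ t → lookup t p) (absorbsˡ (gen p→q)) ⟨
    lookup (arrow p q ∙ z) p         ≡⟨ lookup-∙ (arrow p q) z p ⟩
    lookup z (lookup (arrow p q) p)  ≡⟨ cong (lookup z) (arrow-source p q) ⟩
    lookup z q                       ∎
    where open ≡-Reasoning

  -- From z (p → q) = z: no value of the zero is the tail of an arc.
  zero-avoids-tails : ∀ {p q} → Arc D p q → ∀ w → lookup z w ≢ p
  zero-avoids-tails {p} {q} p→q w zw≡p = arc-irreflexive D loopless p→q (begin
    p                                ≡⟨ zw≡p ⟨
    lookup z w                       ≡⟨ cong (λ t → lookup t w) (absorbsʳ (gen p→q)) ⟨
    lookup (z ∙ arrow p q) w         ≡⟨ lookup-∙ z (arrow p q) w ⟩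
    lookup (arrow p q) (lookup z w)  ≡⟨ cong (lookup (arrow p q)) zw≡p ⟩
    lookup (arrow p q) p             ≡⟨ arrow-source p q ⟩
    q                                ∎)
    where open ≡-Reasoning

  absorbs¹ˡ : ∀ {u} → ⟨ D ⟩¹∋ u → u ∙ z ≡ z
  absorbs¹ˡ (inj₁ refl) = ∙-identityˡ z
  absorbs¹ˡ (inj₂ u∈)   = absorbsˡ u∈

  absorbs¹ʳ : ∀ {u} → ⟨ D ⟩¹∋ u → z ∙ u ≡ z
  absorbs¹ʳ (inj₁ refl) = ∙-identityʳ z
  absorbs¹ʳ (inj₂ u∈)   = absorbsʳ u∈

  below-zero : ∀ {s} → s ≤J[ D ] z → s ≡ z
  below-zero (u , v , u∈ , v∈ , s≡uzv) =
    trans s≡uzv (trans (cong (_∙ v) (absorbs¹ˡ u∈)) (absorbs¹ʳ v∈))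

arc? : ∀ {n} (D : Digraph n) (x y : Fin n) → Dec (Arc D x y)
arc? D x y = D x y Bool.≟ true

only-out-neighbour : ∀ {n} (D : Digraph n) {p p' q : Fin n} →
                     ¬ (∃ λ q' → Arc D p q' × q' ≢ p') → Arc D p q → q ≡ p'
only-out-neighbour D {p' = p'} {q} none p→q with q ≟ p'
... | yes q≡p' = q≡p'
... | no q≢p'  = contradiction (q , p→q , q≢p') none

-- Two arcs x → y and u → v with u, v ≠ x.  In a 0-simple ⟨D⟩ the product
-- (x → y)(u → v) is then the zero (independent-product-zero below).
record IndependentArcs {n : ℕ} (D : Digraph n) : Set where
  field
    x y u v : Fin n
    x→y : Arc D x y
    u→v : Arc D u v
    u≢x : u ≢ x
    v≢x : v ≢ x

-- The common shape of H₁ and H₂ inside D: distinct a, b, c with arcs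
-- b → c, c → b, c → a, and no other arcs except possibly b → a.
record Shape {n : ℕ} (D : Digraph n) : Set where
  field
    a b c : Fin n
    b≢a : b ≢ a
    c≢a : c ≢ a
    b≢c : b ≢ c
    b→c : Arc D b c
    c→b : Arc D c b
    c→a : Arc D c a
    only-arcs : ∀ {w q} → Arc D w q → (w ≡ b × (q ≡ c ⊎ q ≡ a)) ⊎ (w ≡ c × (q ≡ b ⊎ q ≡ a))

module ZeroSimpleDigraph {n : ℕ} (D : Digraph n) (loopless : Loopless D)
                         (zero-simple : ZeroSimple D) where

  open Generated D

  z : Transformation n
  z = proj₁ zero-simple

  z-zero : IsZero D z
  z-zero = proj₁ (proj₂ zero-simple)

  open Zero D loopless z z-zero

  z∈ : ⟨ D ⟩∋ z
  z∈ = proj₁ z-zero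

  nonzero-≤J : ∀ {s t} → ⟨ D ⟩∋ s → ⟨ D ⟩∋ t → s ≢ z → t ≢ z → s ≤J[ D ] t
  nonzero-≤J {s} {t} s∈ t∈ s≢z t≢z =
    proj₁ (Equivalence.from (proj₂ (proj₂ (proj₂ zero-simple)) s t s∈ t∈)
                            (mk⇔ (λ s≡z → contradiction s≡z s≢z) (λ t≡z → contradiction t≡z t≢z)))

  zero-generator-unique : ∀ {x y x' y'} → arrow x y ≡ z → Arc D x' y' → x' ≡ x × y' ≡ y
  zero-generator-unique {x} {y} {x'} {y'} arrow≡z x'→y' with x' ≟ x
  ... | no x'≢x = contradiction z-fixes-x' (zero-avoids-tails x'→y' x')
    where
    z-fixes-x' : lookup z x' ≡ x'
    z-fixes-x' = trans (cong (λ t → lookup t x') (sym arrow≡z)) (arrow-elsewhere y x'≢x)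
  ... | yes refl = refl , sym (begin
    y                        ≡⟨ arrow-source x' y ⟨
    lookup (arrow x' y) x'   ≡⟨ cong (λ t → lookup t x') arrow≡z ⟩
    lookup z x'              ≡⟨ zero-merges-arc x'→y' ⟩
    lookup z y'              ≡⟨ cong (λ t → lookup t y') arrow≡z ⟨
    lookup (arrow x' y) y'   ≡⟨ arrow-elsewhere y (≢-sym (arc-irreflexive D loopless x'→y')) ⟩
    y'                       ∎)
    where open ≡-Reasoning

  NonzeroProduct : Set
  NonzeroProduct = Σ _ λ s → Σ _ λ t → ⟨ D ⟩∋ s × ⟨ D ⟩∋ t × s ∙ t ≢ z

  nonzero-product : NonzeroProduct
  nonzero-product = proj₁ (proj₂ (proj₂ zero-simple))

  -- Hence no generator is zero: otherwise ⟨D⟩ = {z}, contradicting S² ≠ {0}.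
  generator-nonzero : ∀ {x y} → Arc D x y → arrow x y ≢ z
  generator-nonzero {x} {y} x→y arrow≡z = refute nonzero-product
    where
    only-zero : ∀ {r} → ⟨ D ⟩∋ r → r ≡ z
    only-zero (gen x'→y') with zero-generator-unique arrow≡z x'→y'
    ... | refl , refl = arrow≡z
    only-zero (mul r∈ r'∈) = trans (cong₂ _∙_ (only-zero r∈) (only-zero r'∈)) (absorbsˡ z∈)
    refute : NonzeroProduct → ⊥
    refute (s , t , s∈ , t∈ , st≢z) =
      st≢z (trans (cong₂ _∙_ (only-zero s∈) (only-zero t∈)) (absorbsˡ z∈))

  -- Rank argument: for arcs x → y and u → v with u, v ≠ x, the product
  -- g h = (x → y)(u → v) misses both x and u, so it has rank ≤ n − 2, whereas g
  -- has rank n − 1.  If g h were non-zero, then g = s (g h) t, and w ↦ g h (s w)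
  -- would inject Fin n ∖ {x} into Fin n ∖ {x, u}.
  independent-product-zero : ∀ {x y u v} → Arc D x y → Arc D u v → u ≢ x → v ≢ x →
                             arrow x y ∙ arrow u v ≡ z
  independent-product-zero {x} {y} {u} {v} x→y u→v u≢x v≢x
    with Vec.≡-dec _≟_ (arrow x y ∙ arrow u v) z
  ... | yes gh≡z = gh≡z
  ... | no gh≢z  = ⊥-elim (no-injection-into-smaller u≢x r avoids injective)
    where
    g h : Transformation n
    g = arrow x y
    h = arrow u v

    g≢z : g ≢ z
    g≢z g≡z = gh≢z (trans (cong (_∙ h) g≡z) (absorbsʳ (gen u→v)))

    factorisation : g ≤J[ D ] (g ∙ h)
    factorisation = nonzero-≤J (gen x→y) (mul (gen x→y) (gen u→v)) g≢z gh≢z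

    s t : Transformation n
    s = proj₁ factorisation
    t = proj₁ (proj₂ factorisation)

    r : Fin n → Fin n
    r w = lookup h (lookup g (lookup s w))

    avoids : ∀ w → w ≢ x → r w ≢ x × r w ≢ u
    avoids w _ = arrow-avoids (arrow-avoids-source (≢-sym (arc-irreflexive D loopless x→y)) _) v≢x
               , arrow-avoids-source (≢-sym (arc-irreflexive D loopless u→v)) _

    g≡s[gh]t : g ≡ s ∙ (g ∙ h) ∙ t
    g≡s[gh]t = proj₂ (proj₂ (proj₂ (proj₂ factorisation)))

    recovers : ∀ {w} → w ≢ x → lookup t (r w) ≡ w
    recovers {w} w≢x = sym (begin
      w                                       ≡⟨ arrow-elsewhere y w≢x ⟨
      lookup g w                              ≡⟨ cong (λ k → lookup k w) g≡s[gh]t ⟩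
      lookup (s ∙ (g ∙ h) ∙ t) w              ≡⟨ lookup-∙₃ s (g ∙ h) t w ⟩
      lookup t (lookup (g ∙ h) (lookup s w))  ≡⟨ cong (lookup t) (lookup-∙ g h (lookup s w)) ⟩
      lookup t (r w)                          ∎)
      where open ≡-Reasoning

    injective : ∀ {w w'} → w ≢ x → w' ≢ x → r w ≡ r w' → w ≡ w'
    injective w≢x w'≢x eq = trans (sym (recovers w≢x)) (trans (cong (lookup t) eq) (recovers w'≢x))

  -- For an arc c → d with c ≠ a,
  -- write (c → d) = s (a → b) t; at a the left side is a, but (a → b) moves
  -- everything off a and t only moves vertices onto heads of arcs.
  arcs-leave-source : ∀ {a b c d} → Arc D a b → (∀ p → ¬ Arc D p a) → Arc D c d → c ≡ a
  arcs-leave-source {a} {b} {c} {d} a→b no-in c→d with c ≟ a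
  ... | yes c≡a = c≡a
  ... | no c≢a  = ⊥-elim (t-avoids-a (sym (begin
    a                                   ≡⟨ arrow-elsewhere d (≢-sym c≢a) ⟨
    lookup (arrow c d) a                ≡⟨ cong (λ k → lookup k a) c→d≡sgt ⟩
    lookup (s ∙ arrow a b ∙ t) a        ≡⟨ lookup-∙₃ s (arrow a b) t a ⟩
    lookup t q                          ∎)))
    where
    open ≡-Reasoning
    factorisation : arrow c d ≤J[ D ] arrow a b
    factorisation = nonzero-≤J (gen c→d) (gen a→b) (generator-nonzero c→d) (generator-nonzero a→b)

    s t : Transformation n
    s = proj₁ factorisation
    t = proj₁ (proj₂ factorisation)

    c→d≡sgt : arrow c d ≡ s ∙ arrow a b ∙ t
    c→d≡sgt = proj₂ (proj₂ (proj₂ (proj₂ factorisation)))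

    q : Fin n
    q = lookup (arrow a b) (lookup s a)

    t-avoids-a : lookup t q ≢ a
    t-avoids-a tq≡a with moves-onto-heads¹ (proj₁ (proj₂ (proj₂ (proj₂ factorisation)))) q
    ... | inj₁ tq≡q       = arrow-avoids-source (≢-sym (arc-irreflexive D loopless a→b)) _ (trans (sym tq≡q) tq≡a)
    ... | inj₂ (p , p→tq) = no-in p (subst (Arc D p) tq≡a p→tq)

  -- Besides the tail x of an arc x → y there is another tail: otherwise z
  -- fixes every w ≠ x and sends x to z y = y, i.e. z = (x → y), which is non-zero.
  another-tail : ∀ {x y} → Arc D x y → ∃ λ u → u ≢ x × Tail u
  another-tail {x} {y} x→y with any? (λ u → ¬? (u ≟ x) ×-dec any? (arc? D u))
  ... | yes found = found
  ... | no none   = ⊥-elim (generator-nonzero x→y (sym (transformation-ext z≗arrow)))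
    where
    fixed : ∀ {w} → w ≢ x → lookup z w ≡ w
    fixed {w} w≢x with fixes-non-tails z∈ w
    ... | inj₁ zw≡w = zw≡w
    ... | inj₂ tail = contradiction (w , w≢x , tail) none

    z≗arrow : ∀ w → lookup z w ≡ lookup (arrow x y) w
    z≗arrow w with w ≟ x
    ... | yes refl = trans (zero-merges-arc x→y)
                     (trans (fixed (≢-sym (arc-irreflexive D loopless x→y))) (sym (arrow-source w y)))
    ... | no w≢x   = trans (fixed w≢x) (sym (arrow-elsewhere y w≢x))

  -- Independent arcs from an arc x → y and an arc leaving u ≠ x: if neither u
  -- has an out-neighbour other than x nor x one other than u, then {x, u} is
  -- closed under out-arcs, so z x ∈ {x, u}, but z avoids the tails x and u.
  independent-from : ∀ {x y u v₀} → Arc D x y → Arc D u v₀ → u ≢ x → IndependentArcs D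
  independent-from {x} {y} {u} {v₀} x→y u→v₀ u≢x
    with any? (λ v → arc? D u v ×-dec ¬? (v ≟ x))
  ... | yes (v , u→v , v≢x) = record { x→y = x→y ; u→v = u→v ; u≢x = u≢x ; v≢x = v≢x }
  ... | no no-v with any? (λ y' → arc? D x y' ×-dec ¬? (y' ≟ u))
  ...   | yes (y' , x→y' , y'≢u) =
          record { x→y = subst (Arc D u) (only-out-neighbour D no-v u→v₀) u→v₀
                 ; u→v = x→y' ; u≢x = ≢-sym u≢x ; v≢x = y'≢u }
  ...   | no no-y' with preserves-closed InPair closed z∈ {x} (inj₁ refl)
    where
    InPair : Fin n → Set
    InPair w = w ≡ x ⊎ w ≡ u
    closed : ∀ {p q} → Arc D p q → InPair p → InPair q
    closed x→q (inj₁ refl) = inj₂ (only-out-neighbour D no-y' x→q)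
    closed u→q (inj₂ refl) = inj₁ (only-out-neighbour D no-v u→q)
  ...     | inj₁ zx≡x = ⊥-elim (zero-avoids-tails x→y x zx≡x)
  ...     | inj₂ zx≡u = ⊥-elim (zero-avoids-tails u→v₀ x zx≡u)

  independent-arcs : IndependentArcs D
  independent-arcs with has-arc z∈
  ... | x , y , x→y with another-tail x→y
  ...   | u , u≢x , v₀ , u→v₀ = independent-from x→y u→v₀ u≢x

  -- Independent arcs x → y, u → v force the shape with b = x, c = u, a = v.
  -- By the rank argument z = (x → y')(u → v') for all arcs x → y', u → v'
  -- with v' ≠ x; this pins down the values of z and hence all arcs.
  module FromIndependentArcs (pair : IndependentArcs D) where

    open IndependentArcs pair

    zero-value : ∀ {y' v'} → Arc D x y' → Arc D u v' → v' ≢ x →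
                 ∀ w → lookup z w ≡ lookup (arrow u v') (lookup (arrow x y') w)
    zero-value {y'} {v'} x→y' u→v' v'≢x w =
      trans (cong (λ k → lookup k w) (sym (independent-product-zero x→y' u→v' u≢x v'≢x)))
            (lookup-∙ (arrow x y') (arrow u v') w)

    z-at-u : lookup z u ≡ v
    z-at-u = trans (zero-value x→y u→v v≢x u)
             (trans (cong (lookup (arrow u v)) (arrow-elsewhere y u≢x)) (arrow-source u v))

    z-fixes : ∀ {w} → w ≢ x → w ≢ u → lookup z w ≡ w
    z-fixes {w} w≢x w≢u = trans (zero-value x→y u→v v≢x w)
      (trans (cong (lookup (arrow u v)) (arrow-elsewhere y w≢x)) (arrow-elsewhere v w≢u))

    tails : ∀ {w q} → Arc D w q → w ≡ x ⊎ w ≡ u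
    tails {w} w→q with w ≟ x | w ≟ u
    ... | yes w≡x | _       = inj₁ w≡x
    ... | no _    | yes w≡u = inj₂ w≡u
    ... | no w≢x  | no w≢u  = ⊥-elim (zero-avoids-tails w→q w (z-fixes w≢x w≢u))

    -- x and u are each other's in-neighbours: a missing arc between them would
    -- make one of them a source, and arcs would leave both.
    x→u : Arc D x u
    x→u with arc? D x u
    ... | yes x→u = x→u
    ... | no ¬x→u = ⊥-elim (u≢x (sym (arcs-leave-source u→v u-is-source x→y)))
      where
      u-is-source : ∀ p → ¬ Arc D p u
      u-is-source p p→u with tails p→u
      ... | inj₁ refl = ¬x→u p→u
      ... | inj₂ refl = arc-irreflexive D loopless p→u refl

    u→x : Arc D u x
    u→x with arc? D u x
    ... | yes u→x = u→x
    ... | no ¬u→x = ⊥-elim (u≢x (arcs-leave-source x→y x-is-source u→v))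
      where
      x-is-source : ∀ p → ¬ Arc D p x
      x-is-source p p→x with tails p→x
      ... | inj₁ refl = arc-irreflexive D loopless p→x refl
      ... | inj₂ refl = ¬u→x p→x

    z-at-x : lookup z x ≡ v
    z-at-x = trans (zero-merges-arc x→u) z-at-u

    out-of-x : ∀ {q} → Arc D x q → q ≡ u ⊎ q ≡ v
    out-of-x {q} x→q with q ≟ u
    ... | yes q≡u = inj₁ q≡u
    ... | no q≢u  = inj₂ (begin
      q                                     ≡⟨ arrow-elsewhere v q≢u ⟨
      lookup (arrow u v) q                  ≡⟨ cong (lookup (arrow u v)) (arrow-source x q) ⟨
      lookup (arrow u v) (lookup (arrow x q) x)  ≡⟨ zero-value x→q u→v v≢x x ⟨
      lookup z x                            ≡⟨ z-at-x ⟩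
      v                                     ∎)
      where open ≡-Reasoning

    out-of-u : ∀ {q} → Arc D u q → q ≡ x ⊎ q ≡ v
    out-of-u {q} u→q with q ≟ x
    ... | yes q≡x = inj₁ q≡x
    ... | no q≢x  = inj₂ (begin
      q                                     ≡⟨ arrow-source u q ⟨
      lookup (arrow u q) u                  ≡⟨ cong (lookup (arrow u q)) (arrow-elsewhere y u≢x) ⟨
      lookup (arrow u q) (lookup (arrow x y) u)  ≡⟨ zero-value x→y u→q q≢x u ⟨
      lookup z u                            ≡⟨ z-at-u ⟩
      v                                     ∎)
      where open ≡-Reasoning

    only-arcs : ∀ {w q} → Arc D w q → (w ≡ x × (q ≡ u ⊎ q ≡ v)) ⊎ (w ≡ u × (q ≡ x ⊎ q ≡ v))
    only-arcs w→q with tails w→q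
    ... | inj₁ refl = inj₁ (refl , out-of-x w→q)
    ... | inj₂ refl = inj₂ (refl , out-of-u w→q)

    shape-from : Shape D
    shape-from = record
      { a = v ; b = x ; c = u
      ; b≢a = ≢-sym v≢x ; c≢a = arc-irreflexive D loopless u→v ; b≢c = ≢-sym u≢x
      ; b→c = x→u ; c→b = u→x ; c→a = u→v
      ; only-arcs = only-arcs }

  shape : Shape D
  shape = FromIndependentArcs.shape-from independent-arcs

pattern 𝕒 = zero
pattern 𝕓 = suc zero
pattern 𝕔 = suc (suc zero)

H₁-sink : ∀ j → H₁ 𝕒 j ≡ false
H₁-sink 𝕒 = refl
H₁-sink 𝕓 = refl
H₁-sink 𝕔 = refl

H₂-sink : ∀ j → H₂ 𝕒 j ≡ false
H₂-sink 𝕒 = refl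
H₂-sink 𝕓 = refl
H₂-sink 𝕔 = refl

-- A digraph of the shape above has {a, b, c} as its only non-trivial
-- component, isomorphic to H₁ or H₂ according to whether b → a is absent.
module ShapeComponent {n : ℕ} (D : Digraph n) (loopless : Loopless D) (shape : Shape D) where

  open Shape shape

  φ : Fin 3 → Fin n
  φ 𝕒 = a
  φ 𝕓 = b
  φ 𝕔 = c

  φ-injective : ∀ i j → φ i ≡ φ j → i ≡ j
  φ-injective 𝕒 𝕒 _ = refl
  φ-injective 𝕓 𝕓 _ = refl
  φ-injective 𝕔 𝕔 _ = refl
  φ-injective 𝕒 𝕓 a≡b = contradiction (sym a≡b) b≢a
  φ-injective 𝕒 𝕔 a≡c = contradiction (sym a≡c) c≢a
  φ-injective 𝕓 𝕒 b≡a = contradiction b≡a b≢a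
  φ-injective 𝕓 𝕔 b≡c = contradiction b≡c b≢c
  φ-injective 𝕔 𝕒 c≡a = contradiction c≡a c≢a
  φ-injective 𝕔 𝕓 c≡b = contradiction (sym c≡b) b≢c

  InImage : Fin n → Set
  InImage w = ∃ λ i → φ i ≡ w

  adjacent-in-image : ∀ {w q} → Adj D w q → InImage w × InImage q
  adjacent-in-image (inj₁ w→q) with only-arcs w→q
  ... | inj₁ (refl , inj₁ refl) = (𝕓 , refl) , (𝕔 , refl)
  ... | inj₁ (refl , inj₂ refl) = (𝕓 , refl) , (𝕒 , refl)
  ... | inj₂ (refl , inj₁ refl) = (𝕔 , refl) , (𝕓 , refl)
  ... | inj₂ (refl , inj₂ refl) = (𝕔 , refl) , (𝕒 , refl)
  adjacent-in-image (inj₂ q→w) with adjacent-in-image (inj₁ q→w)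
  ... | q∈ , w∈ = w∈ , q∈

  paths-stay-in-image : ∀ {w w'} → InImage w → Connected D w w' → InImage w'
  paths-stay-in-image w∈ ε                    = w∈
  paths-stay-in-image _  (adjacent ◅ path) = paths-stay-in-image (proj₂ (adjacent-in-image adjacent)) path

  φ-connected : ∀ i → Connected D a (φ i)
  φ-connected 𝕒 = ε
  φ-connected 𝕓 = inj₂ c→a ◅ inj₁ c→b ◅ ε
  φ-connected 𝕔 = inj₂ c→a ◅ ε

  a-sink : ∀ q → D a q ≡ false
  a-sink q with D a q in a→q
  ... | false = refl
  ... | true with only-arcs a→q
  ...   | inj₁ (a≡b , _) = contradiction (sym a≡b) b≢a
  ...   | inj₂ (a≡c , _) = contradiction (sym a≡c) c≢a

  component-iso : (H : Digraph 3) → (∀ j → H 𝕒 j ≡ false) → H 𝕓 𝕓 ≡ false → H 𝕔 𝕔 ≡ false →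
                  H 𝕓 𝕔 ≡ true → H 𝕔 𝕓 ≡ true → H 𝕔 𝕒 ≡ true → D b a ≡ H 𝕓 𝕒 →
                  ComponentIso D a H
  component-iso H H-sink H-bb H-cc H-bc H-cb H-ca D-ba =
    φ , φ-injective , φ-connected , (λ w → paths-stay-in-image (𝕒 , refl)) , table
    where
    table : ∀ i j → D (φ i) (φ j) ≡ H i j
    table 𝕒 j = trans (a-sink (φ j)) (sym (H-sink j))
    table 𝕓 𝕒 = D-ba
    table 𝕓 𝕓 = trans (loopless b) (sym H-bb)
    table 𝕓 𝕔 = trans b→c (sym H-bc)
    table 𝕔 𝕒 = trans c→a (sym H-ca)
    table 𝕔 𝕓 = trans c→b (sym H-cb)
    table 𝕔 𝕔 = trans (loopless c) (sym H-cc)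

  unique-component : UniqueComponentIso D
  unique-component = a , (c , c≢a , φ-connected 𝕔) , all-connected , iso
    where
    all-connected : ∀ w → NonTrivial D w → Connected D a w
    all-connected w (_ , q≢w , ε)            = contradiction refl q≢w
    all-connected w (_ , _ , adjacent ◅ _) with proj₁ (adjacent-in-image adjacent)
    ... | i , refl = φ-connected i

    iso : ComponentIso D a H₁ ⊎ ComponentIso D a H₂
    iso with D b a in D-ba
    ... | false = inj₁ (component-iso H₁ H₁-sink refl refl refl refl refl D-ba)
    ... | true  = inj₂ (component-iso H₂ H₂-sink refl refl refl refl refl D-ba)

-- A profile (p , q) is the transformation of {a, b, c} fixing a and mapping
-- b ↦ p, c ↦ q.  As a is a sink of H₁ and H₂, every element of ⟨H⟩ is one.
Profile : Set
Profile = Fin 3 × Fin 3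

apply : Profile → Fin 3 → Fin 3
apply _       𝕒 = 𝕒
apply (p , _) 𝕓 = p
apply (_ , q) 𝕔 = q

-- Composition from left to right, as for transformations.
infixl 7 _⋆_
_⋆_ : Profile → Profile → Profile
(p , q) ⋆ Q = apply Q p , apply Q q

apply-⋆ : ∀ P Q i → apply (P ⋆ Q) i ≡ apply Q (apply P i)
apply-⋆ P Q 𝕒 = refl
apply-⋆ P Q 𝕓 = refl
apply-⋆ P Q 𝕔 = refl

idP : Profile
idP = 𝕓 , 𝕔

apply-idP : ∀ i → apply idP i ≡ i
apply-idP 𝕒 = refl
apply-idP 𝕓 = refl
apply-idP 𝕔 = refl

zeroP : Profile
zeroP = 𝕒 , 𝕒

⋆-zeroP : ∀ P → P ⋆ zeroP ≡ zeroP
⋆-zeroP (p , q) = cong₂ _,_ (to-a p) (to-a q)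
  where
  to-a : ∀ i → apply zeroP i ≡ 𝕒
  to-a 𝕒 = refl
  to-a 𝕓 = refl
  to-a 𝕔 = refl

zeroP-⋆ : ∀ P → zeroP ⋆ P ≡ zeroP
zeroP-⋆ P = refl

-- The profile of (i → j); for i = a, which has no out-arcs, a dummy value.
arrowP : Fin 3 → Fin 3 → Profile
arrowP 𝕒 _ = idP
arrowP 𝕓 j = j , 𝕔
arrowP 𝕔 j = 𝕓 , j

apply-arrowP-source : ∀ {i} j → i ≢ 𝕒 → apply (arrowP i j) i ≡ j
apply-arrowP-source {𝕒} j i≢a = contradiction refl i≢a
apply-arrowP-source {𝕓} j _   = refl
apply-arrowP-source {𝕔} j _   = refl

apply-arrowP-elsewhere : ∀ {i k} j → k ≢ i → apply (arrowP i j) k ≡ k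
apply-arrowP-elsewhere {𝕒} {k} j _ = apply-idP k
apply-arrowP-elsewhere {𝕓} {𝕒} j _ = refl
apply-arrowP-elsewhere {𝕓} {𝕓} j k≢i = contradiction refl k≢i
apply-arrowP-elsewhere {𝕓} {𝕔} j _ = refl
apply-arrowP-elsewhere {𝕔} {𝕒} j _ = refl
apply-arrowP-elsewhere {𝕔} {𝕓} j _ = refl
apply-arrowP-elsewhere {𝕔} {𝕔} j k≢i = contradiction refl k≢i

_≟P_ : DecidableEquality Profile
_≟P_ = ×.≡-dec _≟_ _≟_

data ⟨_⟩ₚ∋_ (H : Digraph 3) : Profile → Set where
  genP : ∀ i j → Arc H i j → ⟨ H ⟩ₚ∋ arrowP i j
  mulP : ∀ {P Q} → ⟨ H ⟩ₚ∋ P → ⟨ H ⟩ₚ∋ Q → ⟨ H ⟩ₚ∋ (P ⋆ Q)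

all-profiles? : {A : Profile → Set} → (∀ P → Dec (A P)) → Dec (∀ P → A P)
all-profiles? A? = map′ (λ all (p , q) → all p q) (λ all p q → all (p , q))
                        (all? λ p → all? λ q → A? (p , q))

any-profile? : {A : Profile → Set} → (∀ P → Dec (A P)) → Dec (∃ A)
any-profile? A? = map′ (λ (p , q , holds) → (p , q) , holds) (λ ((p , q) , holds) → p , q , holds)
                       (any? λ p → any? λ q → A? (p , q))

-- The finitely checkable properties of a table `member` of profiles which
-- together say that it lists a 0-simple semigroup ⟨H⟩ with zero zeroP.
module Certificate (H : Digraph 3) (member : Profile → Bool) where

  Member : Profile → Set
  Member P = member P ≡ true

  Member¹ : Profile → Set
  Member¹ P = P ≡ idP ⊎ Member P

  ContainsGenerators : Set
  ContainsGenerators = ∀ i j → Arc H i j → Member (arrowP i j)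

  Closed : Set
  Closed = ∀ P Q → Member P → Member Q → Member (P ⋆ Q)

  NonzeroJClass : Set
  NonzeroJClass = ∀ P Q → Member P → Member Q → P ≢ zeroP → Q ≢ zeroP →
                  ∃₂ λ U W → Member¹ U × Member¹ W × P ≡ U ⋆ Q ⋆ W

  member? : ∀ P → Dec (Member P)
  member? P = member P Bool.≟ true

  member¹? : ∀ P → Dec (Member¹ P)
  member¹? P = (P ≟P idP) ⊎-dec member? P

  contains-generators? : Dec ContainsGenerators
  contains-generators? = all? λ i → all? λ j → arc? H i j →-dec member? (arrowP i j)

  closed? : Dec Closed
  closed? = all-profiles? λ P → all-profiles? λ Q →
    member? P →-dec member? Q →-dec member? (P ⋆ Q)

  nonzero-J-class? : Dec NonzeroJClass
  nonzero-J-class? = all-profiles? λ P → all-profiles? λ Q →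
    member? P →-dec member? Q →-dec ¬? (P ≟P zeroP) →-dec ¬? (Q ≟P zeroP) →-dec
    any-profile? λ U → any-profile? λ W →
    member¹? U ×-dec member¹? W ×-dec P ≟P (U ⋆ Q ⋆ W)

record CertifiedModel (H : Digraph 3) : Set where
  field
    member : Profile → Bool
  open Certificate H member public
  field
    a-sink              : ∀ j → H 𝕒 j ≡ false
    contains-generators : ContainsGenerators
    closed              : Closed
    generated           : ∀ P → Member P → ⟨ H ⟩ₚ∋ P
    zero-member         : Member zeroP
    nonnull             : ∃ λ P → Member P × P ⋆ P ≢ zeroP
    nonzero-J-class     : NonzeroJClass

members₁ : Profile → Bool
members₁ (𝕒 , 𝕒) = true
members₁ (𝕓 , 𝕒) = true
members₁ (𝕓 , 𝕓) = true
members₁ (𝕔 , 𝕒) = true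
members₁ (𝕔 , 𝕔) = true
members₁ _       = false

members₂ : Profile → Bool
members₂ (𝕒 , _) = true
members₂ (𝕓 , 𝕒) = true
members₂ (𝕓 , 𝕓) = true
members₂ (𝕔 , 𝕒) = true
members₂ (𝕔 , 𝕔) = true
members₂ _       = false

model₁ : CertifiedModel H₁
model₁ = record
  { member              = members₁
  ; a-sink              = H₁-sink
  ; contains-generators = from-yes (Certificate.contains-generators? H₁ members₁)
  ; closed              = from-yes (Certificate.closed? H₁ members₁)
  ; generated           = generated
  ; zero-member         = refl
  ; nonnull             = (𝕔 , 𝕔) , refl , λ ()
  ; nonzero-J-class     = from-yes (Certificate.nonzero-J-class? H₁ members₁)
  }
  where
  generated : ∀ P → members₁ P ≡ true → ⟨ H₁ ⟩ₚ∋ P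
  generated (𝕒 , 𝕒) _ = mulP (genP 𝕓 𝕔 refl) (genP 𝕔 𝕒 refl)
  generated (𝕓 , 𝕒) _ = genP 𝕔 𝕒 refl
  generated (𝕓 , 𝕓) _ = genP 𝕔 𝕓 refl
  generated (𝕔 , 𝕒) _ = mulP (genP 𝕔 𝕒 refl) (genP 𝕓 𝕔 refl)
  generated (𝕔 , 𝕔) _ = genP 𝕓 𝕔 refl

model₂ : CertifiedModel H₂
model₂ = record
  { member              = members₂
  ; a-sink              = H₂-sink
  ; contains-generators = from-yes (Certificate.contains-generators? H₂ members₂)
  ; closed              = from-yes (Certificate.closed? H₂ members₂)
  ; generated           = generated
  ; zero-member         = refl
  ; nonnull             = (𝕔 , 𝕔) , refl , λ ()
  ; nonzero-J-class     = from-yes (Certificate.nonzero-J-class? H₂ members₂)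
  }
  where
  generated : ∀ P → members₂ P ≡ true → ⟨ H₂ ⟩ₚ∋ P
  generated (𝕒 , 𝕒) _ = mulP (genP 𝕔 𝕒 refl) (genP 𝕓 𝕒 refl)
  generated (𝕒 , 𝕓) _ = mulP (genP 𝕓 𝕒 refl) (genP 𝕔 𝕓 refl)
  generated (𝕒 , 𝕔) _ = genP 𝕓 𝕒 refl
  generated (𝕓 , 𝕒) _ = genP 𝕔 𝕒 refl
  generated (𝕓 , 𝕓) _ = genP 𝕔 𝕓 refl
  generated (𝕔 , 𝕒) _ = mulP (genP 𝕔 𝕒 refl) (genP 𝕓 𝕔 refl)
  generated (𝕔 , 𝕔) _ = genP 𝕓 𝕔 refl

-- Transport of a certified model into D along an injection φ of its vertices
-- that carries every arc of D: ⟨D⟩ is then a copy of the model, with the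
-- vertices outside the image of φ fixed, and so it is 0-simple.
module Embedding {n : ℕ} (D : Digraph n) (loopless : Loopless D)
                 {H : Digraph 3} (model : CertifiedModel H)
                 (φ : Fin 3 → Fin n) (φ-injective : ∀ i j → φ i ≡ φ j → i ≡ j)
                 (arcs-in-image : ∀ {w q} → Arc D w q → (∃ λ i → φ i ≡ w) × (∃ λ j → φ j ≡ q))
                 (table : ∀ i j → D (φ i) (φ j) ≡ H i j) where

  open CertifiedModel model

  Outside : Fin n → Set
  Outside w = ∀ i → w ≢ φ i

  in-image-or-outside : ∀ w → (∃ λ i → φ i ≡ w) ⊎ Outside w
  in-image-or-outside w with any? (λ i → φ i ≟ w)
  ... | yes found   = inj₁ found
  ... | no  missing = inj₂ (λ i w≡φi → missing (i , sym w≡φi))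

  extend : Profile → Fin n → Fin n
  extend (p , q) w with w ≟ φ 𝕓 | w ≟ φ 𝕔
  ... | yes _ | _     = φ p
  ... | no _  | yes _ = φ q
  ... | no _  | no _  = w

  embed : Profile → Transformation n
  embed P = tabulate (extend P)

  lookup-embed-φ : ∀ P i → lookup (embed P) (φ i) ≡ φ (apply P i)
  lookup-embed-φ P i = trans (lookup∘tabulate (extend P) (φ i)) (extend-φ P i)
    where
    fixes-rest : ∀ {i} P → φ i ≢ φ 𝕓 → φ i ≢ φ 𝕔 → apply P i ≡ i
    fixes-rest {𝕒} P _     _     = refl
    fixes-rest {𝕓} P i≢b _     = contradiction refl i≢b
    fixes-rest {𝕔} P _     i≢c = contradiction refl i≢c
    extend-φ : ∀ P i → extend P (φ i) ≡ φ (apply P i)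
    extend-φ (p , q) i with φ i ≟ φ 𝕓 | φ i ≟ φ 𝕔
    ... | yes i≡b | _       rewrite φ-injective i 𝕓 i≡b = refl
    ... | no _    | yes i≡c rewrite φ-injective i 𝕔 i≡c = refl
    ... | no i≢b  | no i≢c  = cong φ (sym (fixes-rest (p , q) i≢b i≢c))

  lookup-embed-outside : ∀ P {w} → Outside w → lookup (embed P) w ≡ w
  lookup-embed-outside P {w} outside = trans (lookup∘tabulate (extend P) w) (extend-outside P)
    where
    extend-outside : ∀ P → extend P w ≡ w
    extend-outside (p , q) with w ≟ φ 𝕓 | w ≟ φ 𝕔
    ... | yes w≡b | _       = contradiction w≡b (outside 𝕓)
    ... | no _    | yes w≡c = contradiction w≡c (outside 𝕔)
    ... | no _    | no _    = refl

  embed-unique : ∀ {s} P → (∀ i → lookup s (φ i) ≡ φ (apply P i)) →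
                 (∀ {w} → Outside w → lookup s w ≡ w) → s ≡ embed P
  embed-unique P on-image off-image = transformation-ext λ w → agree w (in-image-or-outside w)
    where
    agree : ∀ w → (∃ λ i → φ i ≡ w) ⊎ Outside w → _
    agree _ (inj₁ (i , refl)) = trans (on-image i) (sym (lookup-embed-φ P i))
    agree _ (inj₂ outside)    = trans (off-image outside) (sym (lookup-embed-outside P outside))

  embed-⋆ : ∀ P Q → embed P ∙ embed Q ≡ embed (P ⋆ Q)
  embed-⋆ P Q = embed-unique (P ⋆ Q) on-image off-image
    where
    open ≡-Reasoning
    on-image : ∀ i → lookup (embed P ∙ embed Q) (φ i) ≡ φ (apply (P ⋆ Q) i)
    on-image i = begin
      lookup (embed P ∙ embed Q) (φ i)          ≡⟨ lookup-∙ (embed P) (embed Q) (φ i) ⟩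
      lookup (embed Q) (lookup (embed P) (φ i)) ≡⟨ cong (lookup (embed Q)) (lookup-embed-φ P i) ⟩
      lookup (embed Q) (φ (apply P i))          ≡⟨ lookup-embed-φ Q (apply P i) ⟩
      φ (apply Q (apply P i))                   ≡⟨ cong φ (apply-⋆ P Q i) ⟨
      φ (apply (P ⋆ Q) i)                       ∎
    off-image : ∀ {w} → Outside w → lookup (embed P ∙ embed Q) w ≡ w
    off-image {w} outside = begin
      lookup (embed P ∙ embed Q) w           ≡⟨ lookup-∙ (embed P) (embed Q) w ⟩
      lookup (embed Q) (lookup (embed P) w)  ≡⟨ cong (lookup (embed Q)) (lookup-embed-outside P outside) ⟩
      lookup (embed Q) w                     ≡⟨ lookup-embed-outside Q outside ⟩
      w                                      ∎

  embed-idP : idT ≡ embed idP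
  embed-idP = embed-unique idP (λ i → trans (lookup-idT (φ i)) (cong φ (sym (apply-idP i))))
                               (λ {w} _ → lookup-idT w)

  embed-injective : ∀ {P Q} → embed P ≡ embed Q → P ≡ Q
  embed-injective {p , q} {p' , q'} eq = cong₂ _,_ (agree-at 𝕓) (agree-at 𝕔)
    where
    agree-at : ∀ i → apply (p , q) i ≡ apply (p' , q') i
    agree-at i = φ-injective _ _ (trans (sym (lookup-embed-φ (p , q) i))
                   (trans (cong (λ s → lookup s (φ i)) eq) (lookup-embed-φ (p' , q') i)))

  embed-arrowP : ∀ {i j} → Arc H i j → arrow (φ i) (φ j) ≡ embed (arrowP i j)
  embed-arrowP {i} {j} i→j = embed-unique (arrowP i j) on-image off-image
    where
    i≢a : i ≢ 𝕒
    i≢a refl with trans (sym i→j) (a-sink j)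
    ... | ()
    on-image : ∀ k → lookup (arrow (φ i) (φ j)) (φ k) ≡ φ (apply (arrowP i j) k)
    on-image k with k ≟ i
    ... | yes refl = trans (arrow-source (φ k) (φ j)) (cong φ (sym (apply-arrowP-source j i≢a)))
    ... | no k≢i   = trans (arrow-elsewhere (φ j) (λ φk≡φi → k≢i (φ-injective k i φk≡φi)))
                           (cong φ (sym (apply-arrowP-elsewhere j k≢i)))
    off-image : ∀ {w} → Outside w → lookup (arrow (φ i) (φ j)) w ≡ w
    off-image outside = arrow-elsewhere (φ j) (outside i)

  elements-embedded : ∀ {s} → ⟨ D ⟩∋ s → ∃ λ P → Member P × s ≡ embed P
  elements-embedded (gen w→q) with arcs-in-image w→q
  ... | (i , refl) , (j , refl) = arrowP i j , contains-generators i j i→j , embed-arrowP i→j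
    where
    i→j : Arc H i j
    i→j = trans (sym (table i j)) w→q
  elements-embedded (mul s∈ t∈) with elements-embedded s∈ | elements-embedded t∈
  ... | P , P∈ , refl | Q , Q∈ , refl = P ⋆ Q , closed P Q P∈ Q∈ , embed-⋆ P Q

  generated-embedded : ∀ {P} → ⟨ H ⟩ₚ∋ P → ⟨ D ⟩∋ embed P
  generated-embedded (genP i j i→j) = subst ⟨ D ⟩∋_ (embed-arrowP i→j) (gen (trans (table i j) i→j))
  generated-embedded (mulP {P} {Q} P∈ Q∈) =
    subst ⟨ D ⟩∋_ (embed-⋆ P Q) (mul (generated-embedded P∈) (generated-embedded Q∈))

  member-embedded : ∀ {P} → Member P → ⟨ D ⟩∋ embed P
  member-embedded {P} P∈ = generated-embedded (generated P P∈)

  member¹-embedded : ∀ {P} → Member¹ P → ⟨ D ⟩¹∋ embed P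
  member¹-embedded (inj₁ refl) = inj₁ (sym embed-idP)
  member¹-embedded (inj₂ P∈)   = inj₂ (member-embedded P∈)

  z : Transformation n
  z = embed zeroP

  z-zero : IsZero D z
  z-zero = member-embedded zero-member , absorbs
    where
    absorbs : ∀ s → ⟨ D ⟩∋ s → (s ∙ z ≡ z) × (z ∙ s ≡ z)
    absorbs s s∈ with elements-embedded s∈
    ... | P , _ , refl = trans (embed-⋆ P zeroP) (cong embed (⋆-zeroP P))
                       , trans (embed-⋆ zeroP P) (cong embed (zeroP-⋆ P))

  open Zero D loopless z z-zero using (below-zero)

  nonzero-≤J : ∀ {s t} → ⟨ D ⟩∋ s → ⟨ D ⟩∋ t → s ≢ z → t ≢ z → s ≤J[ D ] t
  nonzero-≤J s∈ t∈ s≢z t≢z with elements-embedded s∈ | elements-embedded t∈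
  ... | P , P∈ , refl | Q , Q∈ , refl
    with nonzero-J-class P Q P∈ Q∈ (λ P≡0 → s≢z (cong embed P≡0)) (λ Q≡0 → t≢z (cong embed Q≡0))
  ...   | U , W , U∈ , W∈ , P≡UQW =
    embed U , embed W , member¹-embedded U∈ , member¹-embedded W∈ , (begin
      embed P                        ≡⟨ cong embed P≡UQW ⟩
      embed (U ⋆ Q ⋆ W)              ≡⟨ embed-⋆ (U ⋆ Q) W ⟨
      embed (U ⋆ Q) ∙ embed W        ≡⟨ cong (_∙ embed W) (embed-⋆ U Q) ⟨
      embed U ∙ embed Q ∙ embed W    ∎)
    where open ≡-Reasoning

  zero-simple : ZeroSimple D
  zero-simple = z , z-zero , nonnull-embedded nonnull , J-classes
    where
    nonnull-embedded : (∃ λ P → Member P × P ⋆ P ≢ zeroP) →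
                       Σ _ λ s → Σ _ λ t → ⟨ D ⟩∋ s × ⟨ D ⟩∋ t × s ∙ t ≢ z
    nonnull-embedded (P , P∈ , PP≢0) = embed P , embed P , member-embedded P∈ , member-embedded P∈ ,
      λ PP≡z → PP≢0 (embed-injective (trans (sym (embed-⋆ P P)) PP≡z))

    J-classes : ∀ s t → ⟨ D ⟩∋ s → ⟨ D ⟩∋ t → (s J[ D ] t) ⇔ ((s ≡ z) ⇔ (t ≡ z))
    J-classes s t s∈ t∈ = mk⇔ zero-iff J-related
      where
      zero-iff : s J[ D ] t → (s ≡ z) ⇔ (t ≡ z)
      zero-iff (s≤t , t≤s) = mk⇔ (λ { refl → below-zero t≤s }) (λ { refl → below-zero s≤t })
      J-related : (s ≡ z) ⇔ (t ≡ z) → s J[ D ] t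
      J-related s≡z⇔t≡z with Vec.≡-dec _≟_ s z
      ... | yes refl rewrite Equivalence.to s≡z⇔t≡z refl = ≤J-refl z , ≤J-refl z
      ... | no s≢z   = nonzero-≤J s∈ t∈ s≢z t≢z , nonzero-≤J t∈ s∈ t≢z s≢z
        where
        t≢z : t ≢ z
        t≢z t≡z = s≢z (Equivalence.from s≡z⇔t≡z t≡z)

arcs-in-component : ∀ {n} {D : Digraph n} {v : Fin n} → Loopless D →
                    (∀ x → NonTrivial D x → Connected D v x) →
                    ∀ {w q} → Arc D w q → Connected D v w × Connected D v q
arcs-in-component {D = D} loopless all-connected {w} {q} w→q =
    all-connected w (q , ≢-sym (arc-irreflexive D loopless w→q) , inj₁ w→q ◅ ε)
  , all-connected q (w , arc-irreflexive D loopless w→q , inj₂ w→q ◅ ε)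

component-model⇒zero-simple : ∀ {n} (D : Digraph n) {v : Fin n} {H : Digraph 3} → Loopless D →
                              (∀ x → NonTrivial D x → Connected D v x) →
                              CertifiedModel H → ComponentIso D v H → ZeroSimple D
component-model⇒zero-simple D loopless all-connected model (φ , φ-injective , _ , onto , table) =
  Embedding.zero-simple D loopless model φ φ-injective arcs-in-image table
  where
  arcs-in-image : ∀ {w q} → Arc D w q → (∃ λ i → φ i ≡ w) × (∃ λ j → φ j ≡ q)
  arcs-in-image w→q with arcs-in-component loopless all-connected w→q
  ... | v~w , v~q = onto _ v~w , onto _ v~q

proposition6p7 : (n : ℕ) (D : Digraph n) → Loopless D → ZeroSimple D ⇔ UniqueComponentIso D
proposition6p7 n D loopless = mk⇔ forward backward
  where
  forward : ZeroSimple D → UniqueComponentIso D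
  forward zero-simple =
    ShapeComponent.unique-component D loopless (ZeroSimpleDigraph.shape D loopless zero-simple)

  backward : UniqueComponentIso D → ZeroSimple D
  backward (_ , _ , all-connected , inj₁ iso₁) =
    component-model⇒zero-simple D loopless all-connected model₁ iso₁
  backward (_ , _ , all-connected , inj₂ iso₂) =
    component-model⇒zero-simple D loopless all-connected model₂ iso₂
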